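{- Let $\mathbf{B}$ be a finite relational structure with universe $B$, let $I$ be a finite set, and let $T$ be a set of mappings from $I$ to $B$. For each $i \in I$ let $\pi_i : T \to B$ be defined by $\pi_i(t) = t(i)$ (so $\pi_i \in B^T$). The following are equivalent: (1) $T$ is surjectively closed over $\mathbf{B}$; (2) every surjective partial polymorphism $p : B^T \to B$ of $\mathbf{B}$ whose domain is exactly $\{\pi_i \mid i \in I\}$ is automorphism-like.
   Context: A structure $\mathbf{B}$ has a finite signature of relation symbols $R$ with arities $\mathrm{ar}(R)$, a finite universe $B$, and relations $R^{\mathbf{B}} \subseteq B^{\mathrm{ar}(R)}$. A $\wedge$-formula is a conjunction of atoms $R(v_1,\dots,v_k)$ and variable equalities $v = v'$; a map $f$ from its variables to $B$ satisfies it over $\mathbf{B}$ if $(f(v_1),\dots,f(v_k)) \in R^{\mathbf{B}}$ for each atom and $f(v)=f(v')$ for each equality. For a finite set $S$, a set of maps $S \to B$ is $\wedge$-definable over $\mathbf{B}$ if it is the set of all satisfying assignments $S \to B$ of some $\wedge$-formula with variables from $S$; for a set $T$ of maps $S \to B$, $\langle T\rangle_{\mathbf{B}}$ denotes the smallest $\wedge$-definable set of maps $S\to B$ containing $T$. An automorphism of $\mathbf{B}$ is a bijection $\gamma: B\to B$ with $(b_1,\dots,b_k)\in R^{\mathbf{B}} \iff (\gamma(b_1),\dots,\gamma(b_k))\in R^{\mathbf{B}}$ for all $R$. $T$ (a set of maps $I \to B$) is surjectively closed over $\mathbf{B}$ if every surjective map in $\langle T\rangle_{\mathbf{B}}$ lies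 in $\{\gamma\circ t \mid \gamma \text{ an automorphism of } \mathbf{B},\ t\in T\}$. Partial polymorphisms: for a set $T$ of maps from a finite set $I$ to $B$ and a set $J$, a partial map $p: B^J \to B$ is a partial polymorphism of $T$ if for every choice $s: J \to T$, letting $c_i \in B^J$ be $c_i(j) = (s(j))(i)$, whenever $p(c_i)$ is defined for every $i\in I$, the map $i \mapsto p(c_i)$ belongs to $T$. A relation $Q \subseteq B^k$ is viewed as a set of maps $\{1,\dots,k\}\to B$; $p$ is a partial polymorphism of $\mathbf{B}$ if it is a partial polymorphism of every relation of $\mathbf{B}$. $p$ is surjective if its image is $B$. $p : B^J\to B$ is automorphism-like if there exist $j \in J$ and an automorphism $\gamma$ of $\mathbf{B}$ such that for every $h: J \to B$ at which $p$ is defined, $p(h) = \gamma(h(j))$. -}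

module Defs where

open import Data.Nat using (ℕ)
open import Data.Fin using (Fin)
open import Data.Fin.Permutation using (Permutation′; _⟨$⟩ʳ_)
open import Data.Vec using (Vec; map; tabulate; lookup)
open import Data.List using (List)
open import Data.List.Membership.Propositional using (_∈_)
open import Data.List.Relation.Unary.All using (All)
open import Data.Maybe using (Maybe; just)
open import Data.Product using (Σ; ∃; _×_; _,_)
open import Relation.Binary.PropositionalEquality using (_≡_)

record Structure : Set where
  field
    size : ℕ
    nSym : ℕ
    ar   : Fin nSym → ℕ
    rel  : (R : Fin nSym) → List (Vec (Fin size) (ar R))
open Structure public

IsAutomorphism : (𝔹 : Structure) → Permutation′ (size 𝔹) → Set
IsAutomorphism 𝔹 γ =
  ∀ (R : Fin (nSym 𝔹)) (v : Vec (Fin (size 𝔹)) (ar 𝔹 R)) →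
    (v ∈ rel 𝔹 R → map (γ ⟨$⟩ʳ_) v ∈ rel 𝔹 R) ×
    (map (γ ⟨$⟩ʳ_) v ∈ rel 𝔹 R → v ∈ rel 𝔹 R)

Automorphism : Structure → Set
Automorphism 𝔹 = Σ (Permutation′ (size 𝔹)) (IsAutomorphism 𝔹)

data Atom (𝔹 : Structure) (s : ℕ) : Set where
  atom : (R : Fin (nSym 𝔹)) → Vec (Fin s) (ar 𝔹 R) → Atom 𝔹 s
  eq   : Fin s → Fin s → Atom 𝔹 s

Formula : Structure → ℕ → Set
Formula 𝔹 s = List (Atom 𝔹 s)

SatAtom : (𝔹 : Structure) {s : ℕ} → (Fin s → Fin (size 𝔹)) → Atom 𝔹 s → Set
SatAtom 𝔹 f (atom R vs) = map f vs ∈ rel 𝔹 R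
SatAtom 𝔹 f (eq u v)    = f u ≡ f v

Sat : (𝔹 : Structure) {s : ℕ} → (Fin s → Fin (size 𝔹)) → Formula 𝔹 s → Set
Sat 𝔹 f φ = All (SatAtom 𝔹 f) φ

-- A set T of maps Fin k → B, given as an injective enumeration t : Fin m → (Fin k → B)
-- (injective up to pointwise equality of maps).
DistinctMaps : {m k n : ℕ} → (Fin m → Fin k → Fin n) → Set
DistinctMaps {m} {k} t = ∀ (j j′ : Fin m) → (∀ i → t j i ≡ t j′ i) → j ≡ j′

-- Membership in ⟨T⟩_𝔹: the smallest ∧-definable set containing T, i.e. the
-- intersection of all ∧-definable sets containing T.
InClosure : (𝔹 : Structure) {m k : ℕ} → (Fin m → Fin k → Fin (size 𝔹)) →
            (Fin k → Fin (size 𝔹)) → Set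
InClosure 𝔹 {m} {k} t f = ∀ (φ : Formula 𝔹 k) → (∀ (j : Fin m) → Sat 𝔹 (t j) φ) → Sat 𝔹 f φ

SurjectiveMap : {k n : ℕ} → (Fin k → Fin n) → Set
SurjectiveMap {k} {n} f = ∀ (b : Fin n) → ∃ λ (i : Fin k) → f i ≡ b

SurjectivelyClosed : (𝔹 : Structure) {m k : ℕ} → (Fin m → Fin k → Fin (size 𝔹)) → Set
SurjectivelyClosed 𝔹 {m} {k} t =
  ∀ (f : Fin k → Fin (size 𝔹)) → InClosure 𝔹 t f → SurjectiveMap f →
    ∃ λ (γ : Automorphism 𝔹) → ∃ λ (j : Fin m) →
      ∀ (i : Fin k) → f i ≡ (Σ.proj₁ γ ⟨$⟩ʳ t j i)

-- Partial maps B^J → B with J = Fin m; elements of B^J are vectors.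
PartialMap : Structure → ℕ → Set
PartialMap 𝔹 m = Vec (Fin (size 𝔹)) m → Maybe (Fin (size 𝔹))

Defined : {𝔹 : Structure} {m : ℕ} → PartialMap 𝔹 m → Vec (Fin (size 𝔹)) m → Set
Defined {𝔹} p h = ∃ λ (b : Fin (size 𝔹)) → p h ≡ just b

PartialPolymorphismOfRel : (𝔹 : Structure) {m : ℕ} → PartialMap 𝔹 m → Fin (nSym 𝔹) → Set
PartialPolymorphismOfRel 𝔹 {m} p R =
  ∀ (s : Fin m → Vec (Fin (size 𝔹)) (ar 𝔹 R)) → (∀ j → s j ∈ rel 𝔹 R) →
  ∀ (b : Fin (ar 𝔹 R) → Fin (size 𝔹)) →
    (∀ i → p (tabulate (λ j → lookup (s j) i)) ≡ just (b i)) →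
    tabulate b ∈ rel 𝔹 R

PartialPolymorphism : (𝔹 : Structure) {m : ℕ} → PartialMap 𝔹 m → Set
PartialPolymorphism 𝔹 p = ∀ R → PartialPolymorphismOfRel 𝔹 p R

SurjectivePartial : (𝔹 : Structure) {m : ℕ} → PartialMap 𝔹 m → Set
SurjectivePartial 𝔹 p = ∀ (b : Fin (size 𝔹)) → ∃ λ h → p h ≡ just b

AutomorphismLike : (𝔹 : Structure) {m : ℕ} → PartialMap 𝔹 m → Set
AutomorphismLike 𝔹 {m} p =
  ∃ λ (j : Fin m) → ∃ λ (γ : Automorphism 𝔹) →
    ∀ h b → p h ≡ just b → b ≡ (Σ.proj₁ γ ⟨$⟩ʳ lookup h j)

proj : {m k n : ℕ} → (Fin m → Fin k → Fin n) → Fin k → Vec (Fin n) m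
proj t i = tabulate (λ j → t j i)

DomainIsProjections : (𝔹 : Structure) {m k : ℕ} → (Fin m → Fin k → Fin (size 𝔹)) →
                      PartialMap 𝔹 m → Set
DomainIsProjections 𝔹 {m} {k} t p =
  ∀ (h : Vec (Fin (size 𝔹)) m) →
    (Defined {𝔹} p h → ∃ λ (i : Fin k) → h ≡ proj t i) ×
    ((∃ λ (i : Fin k) → h ≡ proj t i) → Defined {𝔹} p h)

-- A partial map p : B^T → B whose domain is {π_i | i ∈ I} is the same thing as a map
-- f : I → B with f i = f i′ whenever π_i = π_i′, via f i = p(π_i).  Under this
-- correspondence p is a partial polymorphism of 𝔹 exactly when f satisfies every atom
-- satisfied by all t ∈ T (that is, f ∈ ⟨T⟩_𝔹), p is surjective exactly when f is, and
-- p(h) = γ(h(j)) on the domain says exactly f = γ ∘ t_j.  So condition (2) is condition (1)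
-- read through the correspondence.
module Submission where

open import Defs
open import Data.Nat using (ℕ)
open import Data.Fin using (Fin)
open import Data.Fin.Properties using (any?) renaming (_≟_ to _≟ᶠ_)
open import Data.Fin.Permutation using (_⟨$⟩ʳ_)
open import Data.Product using (_×_; _,_; proj₁; proj₂; ∃)
open import Data.Vec using (Vec; map; tabulate; lookup)
open import Data.Vec.Properties
  using (≡-dec; lookup∘tabulate; tabulate∘lookup; tabulate-∘; tabulate-cong; lookup-map)
open import Data.List using ([]; _∷_)
open import Data.List.Membership.Propositional using (_∈_)
open import Data.List.Relation.Unary.All using ([]; _∷_; head; tail)
open import Data.Maybe using (just; nothing)
open import Data.Maybe.Properties using (just-injective)
open import Relation.Nullary using (Dec; yes; no; contradiction)
open import Relation.Binary.PropositionalEquality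
open ≡-Reasoning

map-is-tabulate : ∀ {A C : Set} {n} (f : A → C) (xs : Vec A n) →
                  map f xs ≡ tabulate (λ l → f (lookup xs l))
map-is-tabulate f xs = begin
  map f xs                        ≡⟨ cong (map f) (tabulate∘lookup xs) ⟨
  map f (tabulate (lookup xs))    ≡⟨ tabulate-∘ f (lookup xs) ⟨
  tabulate (λ l → f (lookup xs l)) ∎

module _ (𝔹 : Structure) {m k : ℕ} (t : Fin m → Fin k → Fin (size 𝔹)) where

  B : Set
  B = Fin (size 𝔹)

  lookup-proj : ∀ i j → lookup (proj t i) j ≡ t j i
  lookup-proj i j = lookup∘tabulate (λ j → t j i) j

  proj-≡⇒pointwise : ∀ {i i′} → proj t i ≡ proj t i′ → ∀ j → t j i ≡ t j i′
  proj-≡⇒pointwise {i} {i′} e j = begin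
    t j i                ≡⟨ lookup-proj i j ⟨
    lookup (proj t i) j  ≡⟨ cong (λ v → lookup v j) e ⟩
    lookup (proj t i′) j ≡⟨ lookup-proj i′ j ⟩
    t j i′               ∎

  InAutOrbit : (Fin k → B) → Set
  InAutOrbit f = ∃ λ (γ : Automorphism 𝔹) → ∃ λ j → ∀ i → f i ≡ proj₁ γ ⟨$⟩ʳ t j i

  inClosure-fromAtoms : (f : Fin k → B) →
    (∀ a → (∀ j → SatAtom 𝔹 (t j) a) → SatAtom 𝔹 f a) → InClosure 𝔹 t f
  inClosure-fromAtoms f sat [] _ = []
  inClosure-fromAtoms f sat (a ∷ φ) satT =
    sat a (λ j → head (satT j)) ∷ inClosure-fromAtoms f sat φ (λ j → tail (satT j))

  inClosure-atom : ∀ {f} → InClosure 𝔹 t f → ∀ a → (∀ j → SatAtom 𝔹 (t j) a) → SatAtom 𝔹 f a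
  inClosure-atom fᶜ a satT with fᶜ (a ∷ []) (λ j → satT j ∷ [])
  ... | sat ∷ [] = sat

  RespectsProjections : (Fin k → B) → Set
  RespectsProjections f = ∀ {i i′} → proj t i ≡ proj t i′ → f i ≡ f i′

  inClosure-respects-proj : ∀ {f} → InClosure 𝔹 t f → RespectsProjections f
  inClosure-respects-proj fᶜ {i} {i′} e = inClosure-atom fᶜ (eq i i′) (proj-≡⇒pointwise e)

  -- The values of p at the projections satisfy every atom that T satisfies: an atom
  -- R(v_1, …, v_r) holding in every t_j feeds p the columns π_{v_1}, …, π_{v_r}.
  partialPolymorphism⇒inClosure : (p : PartialMap 𝔹 m) → PartialPolymorphism 𝔹 p →
    (f : Fin k → B) → (∀ i → p (proj t i) ≡ just (f i)) → InClosure 𝔹 t f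
  partialPolymorphism⇒inClosure p pp f pπ = inClosure-fromAtoms f sat
    where
      sat : ∀ a → (∀ j → SatAtom 𝔹 (t j) a) → SatAtom 𝔹 f a
      sat (eq u v) satT = just-injective (begin
        just (f u)     ≡⟨ pπ u ⟨
        p (proj t u)   ≡⟨ cong p (tabulate-cong satT) ⟩
        p (proj t v)   ≡⟨ pπ v ⟩
        just (f v)     ∎)
      sat (atom R vs) satT = subst (_∈ rel 𝔹 R) (sym (map-is-tabulate f vs))
        (pp R (λ j → map (t j) vs) satT (λ l → f (lookup vs l)) λ l → begin
          p (tabulate (λ j → lookup (map (t j) vs) l)) ≡⟨ cong p (tabulate-cong (λ j → lookup-map l (t j) vs)) ⟩
          p (proj t (lookup vs l))                       ≡⟨ pπ (lookup vs l) ⟩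
          just (f (lookup vs l))                         ∎)

  isProjection? : (h : Vec B m) → Dec (∃ λ i → h ≡ proj t i)
  isProjection? h = any? (λ i → ≡-dec _≟ᶠ_ h (proj t i))

  extendByProjections : (Fin k → B) → PartialMap 𝔹 m
  extendByProjections f h with isProjection? h
  ... | yes (i , _) = just (f i)
  ... | no _        = nothing

  module _ (f : Fin k → B) where

    private
      p : PartialMap 𝔹 m
      p = extendByProjections f

    extendByProjections-defined⇒proj : ∀ h b → p h ≡ just b → ∃ λ i → h ≡ proj t i × f i ≡ b
    extendByProjections-defined⇒proj h b ph with isProjection? h
    ... | yes (i , h≡πᵢ) = i , h≡πᵢ , just-injective ph

    extendByProjections-proj : RespectsProjections f → ∀ i → p (proj t i) ≡ just (f i)
    extendByProjections-proj resp i with isProjection? (proj t i)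
    ... | yes (i′ , πᵢ≡πᵢ′) = cong just (resp (sym πᵢ≡πᵢ′))
    ... | no ¬proj          = contradiction (i , refl) ¬proj

    extendByProjections-domain : RespectsProjections f → DomainIsProjections 𝔹 t p
    extendByProjections-domain resp h =
      (λ (b , ph) → let (i , h≡πᵢ , _) = extendByProjections-defined⇒proj h b ph in i , h≡πᵢ) ,
      (λ { (i , refl) → f i , extendByProjections-proj resp i })

    extendByProjections-surjective : RespectsProjections f →
                                     SurjectiveMap f → SurjectivePartial 𝔹 p
    extendByProjections-surjective resp surj b with surj b
    ... | i , refl = proj t i , extendByProjections-proj resp i

    -- Each column of a tuple of R-tuples in the domain is some π_{g l}; then every t_j maps
    -- the variable tuple g to the j-th R-tuple, and f maps it to the image tuple.
    extendByProjections-partialPolymorphism : InClosure 𝔹 t f → PartialPolymorphism 𝔹 p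
    extendByProjections-partialPolymorphism fᶜ R s sᴿ b pb =
      subst (_∈ rel 𝔹 R) f∘g≡b
        (inClosure-atom fᶜ (atom R (tabulate g)) (λ j → subst (_∈ rel 𝔹 R) (sym (t∘g≡s j)) (sᴿ j)))
      where
        column : Fin (ar 𝔹 R) → Vec B m
        column l = tabulate (λ j → lookup (s j) l)
        column-proj : ∀ l → ∃ λ i → column l ≡ proj t i × f i ≡ b l
        column-proj l = extendByProjections-defined⇒proj (column l) (b l) (pb l)
        g : Fin (ar 𝔹 R) → Fin k
        g l = proj₁ (column-proj l)
        t∘g≡s : ∀ j → map (t j) (tabulate g) ≡ s j
        t∘g≡s j = begin
          map (t j) (tabulate g)    ≡⟨ tabulate-∘ (t j) g ⟨
          tabulate (λ l → t j (g l)) ≡⟨ tabulate-cong (λ l → begin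
              t j (g l)                 ≡⟨ lookup-proj (g l) j ⟨
              lookup (proj t (g l)) j   ≡⟨ cong (λ v → lookup v j) (proj₁ (proj₂ (column-proj l))) ⟨
              lookup (column l) j       ≡⟨ lookup∘tabulate (λ j → lookup (s j) l) j ⟩
              lookup (s j) l            ∎) ⟩
          tabulate (lookup (s j))    ≡⟨ tabulate∘lookup (s j) ⟩
          s j                        ∎
        f∘g≡b : map f (tabulate g) ≡ tabulate b
        f∘g≡b = trans (sym (tabulate-∘ f g)) (tabulate-cong (λ l → proj₂ (proj₂ (column-proj l))))

  module _ (p : PartialMap 𝔹 m) (dom : DomainIsProjections 𝔹 t p) where

    valueAtProj : Fin k → B
    valueAtProj i = proj₁ (proj₂ (dom (proj t i)) (i , refl))

    valueAtProj-spec : ∀ i → p (proj t i) ≡ just (valueAtProj i)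
    valueAtProj-spec i = proj₂ (proj₂ (dom (proj t i)) (i , refl))

    valueAtProj-surjective : SurjectivePartial 𝔹 p → SurjectiveMap valueAtProj
    valueAtProj-surjective surj b with surj b
    ... | h , ph with proj₁ (dom h) (b , ph)
    ... | i , refl = i , just-injective (trans (sym (valueAtProj-spec i)) ph)

    inAutOrbit⇒automorphismLike : InAutOrbit valueAtProj → AutomorphismLike 𝔹 p
    inAutOrbit⇒automorphismLike (γ , j , f≡γtⱼ) = j , γ , onDomain
      where
        onDomain : ∀ h b → p h ≡ just b → b ≡ proj₁ γ ⟨$⟩ʳ lookup h j
        onDomain h b ph with proj₁ (dom h) (b , ph)
        ... | i , refl = begin
          b                                ≡⟨ just-injective (trans (sym ph) (valueAtProj-spec i)) ⟩
          valueAtProj i                    ≡⟨ f≡γtⱼ i ⟩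
          proj₁ γ ⟨$⟩ʳ t j i               ≡⟨ cong (proj₁ γ ⟨$⟩ʳ_) (lookup-proj i j) ⟨
          proj₁ γ ⟨$⟩ʳ lookup (proj t i) j ∎

  automorphismLike⇒inAutOrbit : (p : PartialMap 𝔹 m) (f : Fin k → B) →
    (∀ i → p (proj t i) ≡ just (f i)) → AutomorphismLike 𝔹 p → InAutOrbit f
  automorphismLike⇒inAutOrbit p f pπ (j , γ , onDomain) = γ , j , λ i → begin
    f i                              ≡⟨ onDomain (proj t i) (f i) (pπ i) ⟩
    proj₁ γ ⟨$⟩ʳ lookup (proj t i) j ≡⟨ cong (proj₁ γ ⟨$⟩ʳ_) (lookup-proj i j) ⟩
    proj₁ γ ⟨$⟩ʳ t j i               ∎

  surjectivelyClosed⇒automorphismLike : SurjectivelyClosed 𝔹 t →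
    ∀ (p : PartialMap 𝔹 m) → PartialPolymorphism 𝔹 p → SurjectivePartial 𝔹 p →
      DomainIsProjections 𝔹 t p → AutomorphismLike 𝔹 p
  surjectivelyClosed⇒automorphismLike closed p pp surj dom =
    inAutOrbit⇒automorphismLike p dom
      (closed (valueAtProj p dom)
              (partialPolymorphism⇒inClosure p pp (valueAtProj p dom) (valueAtProj-spec p dom))
              (valueAtProj-surjective p dom surj))

  automorphismLike⇒surjectivelyClosed :
    (∀ (p : PartialMap 𝔹 m) → PartialPolymorphism 𝔹 p → SurjectivePartial 𝔹 p →
       DomainIsProjections 𝔹 t p → AutomorphismLike 𝔹 p) →
    SurjectivelyClosed 𝔹 t
  automorphismLike⇒surjectivelyClosed autLike f fᶜ surj =
    automorphismLike⇒inAutOrbit (extendByProjections f) f (extendByProjections-proj f respects)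
      (autLike (extendByProjections f)
               (extendByProjections-partialPolymorphism f fᶜ)
               (extendByProjections-surjective f respects surj)
               (extendByProjections-domain f respects))
    where
      respects : RespectsProjections f
      respects = inClosure-respects-proj fᶜ

-- The enumeration of T need not be injective: both conditions only depend on its image.
proposition2p1 : (𝔹 : Structure) (m k : ℕ) (t : Fin m → Fin k → Fin (size 𝔹)) →
    DistinctMaps t →
    (SurjectivelyClosed 𝔹 t →
       ∀ (p : PartialMap 𝔹 m) → PartialPolymorphism 𝔹 p → SurjectivePartial 𝔹 p →
         DomainIsProjections 𝔹 t p → AutomorphismLike 𝔹 p)
    ×
    ((∀ (p : PartialMap 𝔹 m) → PartialPolymorphism 𝔹 p → SurjectivePartial 𝔹 p →
         DomainIsProjections 𝔹 t p → AutomorphismLike 𝔹 p) →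
       SurjectivelyClosed 𝔹 t)
proposition2p1 𝔹 m k t _ =
  surjectivelyClosed⇒automorphismLike 𝔹 t , automorphismLike⇒surjectivelyClosed 𝔹 t
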